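{- Let $T_f$ be a caterpillar with $n$ vertices, spine $v_0,\dots,v_s$ ($s\ge1$) and leaf sequence $f=(f_0,\dots,f_s)$. Then $$[m^n_{1^n}]X_{T_f}^{T_f}=\bigl(1+\mathbb{1}\{\mathrm{rev}(f)=f\}\bigr)\prod_{i=0}^{s}f_i!,$$ where $\mathrm{rev}(f)=(f_s,\dots,f_0)$ and $\mathbb{1}\{\mathrm{rev}(f)=f\}$ is $1$ if $\mathrm{rev}(f)=f$ and $0$ otherwise.
   Context: A caterpillar is a tree such that deleting all its leaves leaves a path with at least two vertices (the spine) $v_0,v_1,\dots,v_s$, $s\ge 1$ (in this order, up to reversal). $f_i$ is the number of leaves adjacent to $v_i$ (so $f_0,f_s\ge1$), and $T_f$ denotes the caterpillar with $f=(f_0,\dots,f_s)$. A graph homomorphism $G\to H$ is a vertex map sending edges to edges; its type is the partition of nonzero preimage sizes. For a partition $\lambda$ with $r_i(\lambda)$ parts equal to $i$, $m_\lambda^N=\frac{N!}{\binom{N}{r_1(\lambda),r_2(\lambda),\dots,N-\ell(\lambda)}}m_\lambda$ with $m_\lambda$ the monomial symmetric function. The $H$-chromatic symmetric function is $X_G^H=\sum_\lambda d_\lambda m_\lambda^{|V(H)|}$, $d_\lambda$ the number of homomorphisms $G\to H$ of type $\lambda$; $[m^n_\lambda]X$ denotes the coefficient $d_\lambda$ of $m^n_\lambda$ in this expansion (with $n=|V(H)|$). -}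

module Defs where

open import Data.Nat using (ℕ; zero; suc; _+_; _*_; _∸_; _≡ᵇ_; _≟_)
open import Data.Nat using (_!)
open import Data.Bool using (Bool; true; false; _∧_; _∨_; if_then_else_)
open import Data.Fin using (Fin; toℕ)
open import Data.Product using (_×_; _,_)
open import Data.List using (List; []; _∷_; _++_; map; length; upTo; allFin; concatMap; reverse)
open import Data.Nat.ListAction using (sum; product)
open import Data.Bool.ListAction using (any; all)
open import Data.List.Properties using (≡-dec)
open import Data.Vec using (Vec; []; _∷_; toList)
open import Relation.Nullary.Decidable using (⌊_⌋)

-- Vertex labelling (vertices are 0 .. n-1, n = (s+1) + Σ f_i):
--   spine vertex v_i is i (0 ≤ i ≤ s);
--   the leaves of v_i are the next f_i consecutive numbers after those of v_{i-1},
--   starting at s+1.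

numVertices : List ℕ → ℕ
numVertices f = length f + sum f

spineEdges : ℕ → List (ℕ × ℕ)
spineEdges s = map (λ i → (i , suc i)) (upTo s)

leafEdges : ℕ → ℕ → List ℕ → List (ℕ × ℕ)
leafEdges i c [] = []
leafEdges i c (k ∷ ks) = map (λ j → (i , c + j)) (upTo k) ++ leafEdges (suc i) (c + k) ks

edges : List ℕ → List (ℕ × ℕ)
edges f = spineEdges (length f ∸ 1) ++ leafEdges 0 (length f) f

adj : List ℕ → ℕ → ℕ → Bool
adj f u v = any (λ { (x , y) → ((u ≡ᵇ x) ∧ (v ≡ᵇ y)) ∨ ((u ≡ᵇ y) ∧ (v ≡ᵇ x)) }) (edges f)

-- a vertex map V → V (V = {0..n-1}) is encoded as a vector h with h[x] = image of x
app : ∀ {m k} → Vec (Fin k) m → ℕ → ℕ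
app [] _ = 0
app (x ∷ xs) zero = toℕ x
app (x ∷ xs) (suc i) = app xs i

isHom : (f : List ℕ) → Vec (Fin (numVertices f)) (numVertices f) → Bool
isHom f h = all (λ { (x , y) → adj f (app h x) (app h y) }) (edges f)

countB : {A : Set} → (A → Bool) → List A → ℕ
countB p [] = 0
countB p (x ∷ xs) = (if p x then 1 else 0) + countB p xs

preimageSize : ∀ {m k} → Vec (Fin k) m → ℕ → ℕ
preimageSize h w = countB (λ x → toℕ x ≡ᵇ w) (toList h)

-- the type of h (partition of nonzero preimage sizes) is 1^n, n = |V(H)|:
-- every one of the n target vertices has preimage of size exactly 1
hasType1n : ∀ {m n} → Vec (Fin n) m → Bool
hasType1n {n = n} h = all (λ w → preimageSize h w ≡ᵇ 1) (upTo n)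

allMaps : (m k : ℕ) → List (Vec (Fin k) m)
allMaps zero k = [] ∷ []
allMaps (suc m) k = concatMap (λ x → map (x ∷_) (allMaps m k)) (allFin k)

-- [m^n_{1^n}] X^{T_f}_{T_f} : number of homomorphisms T_f → T_f of type 1^n
coeff1n : List ℕ → ℕ
coeff1n f = countB (λ h → isHom f h ∧ hasType1n h) (allMaps (numVertices f) (numVertices f))

onePlusPalInd : List ℕ → ℕ
onePlusPalInd f = if ⌊ ≡-dec _≟_ (reverse f) f ⌋ then 2 else 1

prodFact : List ℕ → ℕ
prodFact f = product (map (_!) f)

{-# OPTIONS --safe #-}
module Submission where

-- A homomorphism of type 1^n is a bijection, so [m^n_{1^n}] X^{T_f}_{T_f} counts the automorphisms
-- of T_f. Colour every vertex by its role: spine j for v_j, leaf j for the leaves of v_j. Since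
-- f₀, fₛ ≥ 1, every spine vertex has two distinct neighbours while a leaf has only one, so an
-- automorphism maps the spine onto itself, hence acts on it as i ↦ i or i ↦ s ∸ i; a leaf of v_j
-- must then go to a leaf of the image of v_j. So the automorphisms are exactly the bijections
-- that preserve the colours, or reflect them. Placing the vertices one at a time, the first kind
-- are counted by ∏ fᵢ!, the second by ∏ fₛ₋ᵢ (fₛ₋ᵢ - 1) ⋯ (fₛ₋ᵢ - fᵢ + 1), which equals ∏ fᵢ!
-- when f is a palindrome and 0 otherwise.

open import Defs
open import Algebra.Properties.CommutativeSemigroup as CommSemigroupProperties using ()
open import Data.Bool using (Bool; true; false; T; not; _∧_; _∨_; if_then_else_)
open import Data.Bool.Properties using (T-∧; T-∨; T-≡; ∧-assoc)
open import Data.Empty using (⊥; ⊥-elim)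
open import Data.Fin using (Fin; toℕ)
open import Data.Fin.Properties using (toℕ<n)
open import Data.List using (List; []; _∷_; _++_; _∷ʳ_; length; map; replicate; reverse; upTo; applyUpTo; allFin; tabulate; concatMap)
open import Data.List.Membership.Propositional using (_∈_; find; lose)
open import Data.List.Membership.Propositional.Properties
  using (∈-upTo⁺; ∈-upTo⁻; ∈-map⁺; ∈-map⁻; ∈-++⁺ˡ; ∈-++⁺ʳ; ∈-++⁻)
open import Data.List.Properties
  using ( ≡-dec; length-++; length-map; length-replicate; length-applyUpTo; length-upTo; length-reverse
        ; map-++; map-id; map-cong; map-replicate; map-tabulate; map-upTo; map-applyUpTo; unfold-reverse )
open import Data.List.Relation.Binary.Permutation.Propositional.Properties using (↭-reverse)
open import Data.List.Relation.Binary.Pointwise using (Pointwise; []; _∷_)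
open import Data.List.Relation.Unary.All as All using (All; []; _∷_)
open import Data.List.Relation.Unary.All.Properties using (all⁺; all⁻; applyUpTo⁺₁; map⁺; map⁻; ++⁺; replicate⁺)
open import Data.List.Relation.Unary.Any.Properties using (any⁺; any⁻)
open import Data.Nat using (ℕ; zero; suc; _+_; _*_; _∸_; _≤_; _<_; _≡ᵇ_; _!; z≤n; s≤s; z<s)
open import Data.Nat.ListAction using (sum)
open import Data.Nat.ListAction.Properties using (sum-↭)
open import Data.Nat.Properties
  using ( _≟_; _<?_; ≡ᵇ⇒≡; ≡⇒≡ᵇ; suc-injective; 0≢1+n; 1+n≢0
        ; ≤-refl; ≤-reflexive; ≤-trans; ≤-antisym; ≤-pred
        ; <⇒≤; <⇒≢; <⇒≱; ≮⇒≥; n≤1+n; m<n⇒m<1+n; m≤m+n; m≤n+m; n≤0⇒n≡0; m≤n⇒m<n∨m≡n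
        ; +-comm; +-assoc; +-suc; +-identityʳ; +-commutativeSemigroup; *-assoc; *-identityˡ; *-zeroʳ
        ; +-mono-≤; +-monoˡ-≤; +-monoʳ-≤; +-monoʳ-<; +-cancelˡ-≤; +-cancelʳ-≤; +-cancelˡ-<; +-cancelˡ-≡; +-cancelʳ-≡
        ; m+n∸m≡n; m+n∸n≡m; m∸n≤m; m∸[m∸n]≡n; n∸n≡0; +-∸-assoc; ∸-cancelˡ-≡ )
open import Data.Product using (_×_; _,_; proj₁; proj₂; ∃)
open import Data.Sum using (_⊎_; inj₁; inj₂)
open import Data.Vec using (Vec; []; _∷_)
open import Function using (_∘_; id; case_of_; _⇔_; mk⇔; Equivalence)
open import Relation.Binary.Definitions using (DecidableEquality)
open import Relation.Binary.PropositionalEquality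
  using (_≡_; _≢_; refl; sym; trans; subst; subst₂; cong; cong₂; module ≡-Reasoning)
open import Relation.Nullary using (¬_; Dec; does; yes; no)
open import Relation.Nullary.Decidable using (map′; dec-true; dec-false)

open CommSemigroupProperties +-commutativeSemigroup using (x∙yz≈y∙xz; interchange)

does-sound : ∀ {P : Set} (p? : Dec P) → T (does p?) → P
does-sound (yes p) _ = p

does-complete : ∀ {P : Set} (p? : Dec P) → P → T (does p?)
does-complete (yes _) _ = _
does-complete (no ¬p) p = ¬p p

T-≡true : ∀ {b} → T b → b ≡ true
T-≡true = Equivalence.to T-≡

T-not⇒¬T : ∀ {b} → T (not b) → ¬ T b
T-not⇒¬T {true}  ()
T-not⇒¬T {false} _  ()

¬T⇒T-not : ∀ {b} → ¬ T b → T (not b)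
¬T⇒T-not {true}  ¬t = ¬t _
¬T⇒T-not {false} _  = _

T-injective : ∀ {a b} → T a ⇔ T b → a ≡ b
T-injective {true}  {true}  _ = refl
T-injective {true}  {false} e = ⊥-elim (Equivalence.to e _)
T-injective {false} {true}  e = ⊥-elim (Equivalence.from e _)
T-injective {false} {false} _ = refl

ind : Bool → ℕ
ind b = if b then 1 else 0

if-then-0-cong : ∀ b {x y : ℕ} → (T b → x ≡ y) → (if b then x else 0) ≡ (if b then y else 0)
if-then-0-cong true  x≡y = x≡y _
if-then-0-cong false _   = refl

module _ {A : Set} where

  countB-++ : (p : A → Bool) (xs ys : List A) → countB p (xs ++ ys) ≡ countB p xs + countB p ys
  countB-++ p []       ys = refl
  countB-++ p (x ∷ xs) ys = trans (cong (ind (p x) +_) (countB-++ p xs ys)) (sym (+-assoc (ind (p x)) _ _))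

  countB-cong : {p q : A → Bool} → (∀ x → p x ≡ q x) → (xs : List A) → countB p xs ≡ countB q xs
  countB-cong p≗q []       = refl
  countB-cong p≗q (x ∷ xs) = cong₂ (λ b m → ind b + m) (p≗q x) (countB-cong p≗q xs)

  countB-false : (xs : List A) → countB (λ _ → false) xs ≡ 0
  countB-false []       = refl
  countB-false (x ∷ xs) = countB-false xs

  countB-none : {p : A → Bool} {xs : List A} → All (λ x → ¬ T (p x)) xs → countB p xs ≡ 0
  countB-none {xs = []}         []           = refl
  countB-none {p} {xs = x ∷ xs} (¬px ∷ ¬pxs) with p x
  ... | true  = ⊥-elim (¬px _)
  ... | false = countB-none ¬pxs

  countB-replicate : {p : A → Bool} {x : A} → ∀ k → T (p x) → countB p (replicate k x) ≡ k
  countB-replicate zero    _  = refl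
  countB-replicate (suc k) px = cong₂ (λ b m → ind b + m) (T-≡true px) (countB-replicate k px)

  countB-∧ : (b : Bool) (q : A → Bool) (xs : List A) → countB (λ x → b ∧ q x) xs ≡ (if b then countB q xs else 0)
  countB-∧ true  q xs = refl
  countB-∧ false q xs = countB-false xs

  countB-∨-disjoint : (p q : A → Bool) → (∀ x → T (p x) → T (q x) → ⊥) → (xs : List A) →
                      countB (λ x → p x ∨ q x) xs ≡ countB p xs + countB q xs
  countB-∨-disjoint p q disjoint []       = refl
  countB-∨-disjoint p q disjoint (x ∷ xs) with p x | q x | disjoint x
  ... | true  | true  | both = ⊥-elim (both _ _)
  ... | true  | false | _    = cong suc (countB-∨-disjoint p q disjoint xs)
  ... | false | true  | _    = trans (cong suc (countB-∨-disjoint p q disjoint xs)) (sym (+-suc _ _))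
  ... | false | false | _    = countB-∨-disjoint p q disjoint xs

  sum-if : (b : A → Bool) (k : ℕ) (xs : List A) → sum (map (λ x → if b x then k else 0) xs) ≡ countB b xs * k
  sum-if b k []       = refl
  sum-if b k (x ∷ xs) with b x
  ... | true  = cong (k +_) (sum-if b k xs)
  ... | false = sum-if b k xs

  sum-map-ind : (p : A → Bool) (xs : List A) → sum (map (ind ∘ p) xs) ≡ countB p xs
  sum-map-ind p []       = refl
  sum-map-ind p (x ∷ xs) = cong (ind (p x) +_) (sum-map-ind p xs)

  sum-map-+ : (g g′ : A → ℕ) (xs : List A) → sum (map (λ x → g x + g′ x) xs) ≡ sum (map g xs) + sum (map g′ xs)
  sum-map-+ g g′ []       = refl
  sum-map-+ g g′ (x ∷ xs) = trans (cong (g x + g′ x +_) (sum-map-+ g g′ xs)) (interchange (g x) (g′ x) _ _)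

  sum-map-0 : (xs : List A) → sum (map (λ _ → 0) xs) ≡ 0
  sum-map-0 []       = refl
  sum-map-0 (x ∷ xs) = sum-map-0 xs

module _ {A B : Set} where

  countB-map : (p : B → Bool) (g : A → B) (xs : List A) → countB p (map g xs) ≡ countB (p ∘ g) xs
  countB-map p g []       = refl
  countB-map p g (x ∷ xs) = cong (ind (p (g x)) +_) (countB-map p g xs)

  countB-concatMap : (p : B → Bool) (g : A → List B) (xs : List A) →
                     countB p (concatMap g xs) ≡ sum (map (countB p ∘ g) xs)
  countB-concatMap p g []       = refl
  countB-concatMap p g (x ∷ xs) =
    trans (countB-++ p (g x) (concatMap g xs)) (cong (countB p (g x) +_) (countB-concatMap p g xs))

≤1-sum≡length⇒≡1 : ∀ {xs} → All (_≤ 1) xs → sum xs ≡ length xs → All (_≡ 1) xs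
≤1-sum≡length⇒≡1 {[]}     []           _ = []
≤1-sum≡length⇒≡1 {x ∷ xs} (x≤1 ∷ xs≤1) e =
  x≡1 ∷ ≤1-sum≡length⇒≡1 xs≤1 (≤-antisym (sum≤length xs≤1) length≤sum)
  where
  sum≤length : ∀ {ys} → All (_≤ 1) ys → sum ys ≤ length ys
  sum≤length []           = z≤n
  sum≤length (y≤1 ∷ ys≤1) = +-mono-≤ y≤1 (sum≤length ys≤1)
  x≡1 : x ≡ 1
  x≡1 = ≤-antisym x≤1 (+-cancelʳ-≤ (length xs) 1 x (subst (_≤ x + length xs) e (+-monoʳ-≤ x (sum≤length xs≤1))))
  length≤sum : length xs ≤ sum xs
  length≤sum = +-cancelˡ-≤ 1 (length xs) (sum xs) (subst (_≤ 1 + sum xs) e (+-monoˡ-≤ (sum xs) x≤1))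

tabulate-toℕ : ∀ {A : Set} n (φ : ℕ → A) → tabulate {n = n} (φ ∘ toℕ) ≡ applyUpTo φ n
tabulate-toℕ zero    φ = refl
tabulate-toℕ (suc n) φ = cong (φ 0 ∷_) (tabulate-toℕ n (φ ∘ suc))

countB-allFin : ∀ n (p : ℕ → Bool) → countB (p ∘ toℕ) (allFin n) ≡ countB p (upTo n)
countB-allFin n p = begin
  countB (p ∘ toℕ) (allFin n)    ≡⟨ countB-map p toℕ (allFin n) ⟨
  countB p (map toℕ (allFin n))  ≡⟨ cong (countB p) (trans (map-tabulate id toℕ) (tabulate-toℕ n id)) ⟩
  countB p (upTo n)              ∎
  where open ≡-Reasoning

countB-upTo-suc : ∀ n (p : ℕ → Bool) → countB p (upTo (suc n)) ≡ ind (p 0) + countB (p ∘ suc) (upTo n)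
countB-upTo-suc n p =
  cong (ind (p 0) +_) (trans (cong (countB p) (sym (map-upTo suc n))) (countB-map p suc (upTo n)))

countB-upTo-≡ᵇ : ∀ {n a} → a < n → countB (a ≡ᵇ_) (upTo n) ≡ 1
countB-upTo-≡ᵇ {suc n} {zero}  _         = trans (countB-upTo-suc n (0 ≡ᵇ_)) (cong suc (countB-false (upTo n)))
countB-upTo-≡ᵇ {suc n} {suc a} (s≤s a<n) = trans (countB-upTo-suc n (suc a ≡ᵇ_)) (countB-upTo-≡ᵇ a<n)

countB-upTo-split : ∀ {n a} (p : ℕ → Bool) → a < n →
                    countB p (upTo n) ≡ ind (p a) + countB (λ z → not (z ≡ᵇ a) ∧ p z) (upTo n)
countB-upTo-split {suc n} {zero} p _ = begin
  countB p (upTo (suc n))                                      ≡⟨ countB-upTo-suc n p ⟩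
  ind (p 0) + countB (p ∘ suc) (upTo n)                        ≡⟨ cong (ind (p 0) +_) (countB-upTo-suc n p₀) ⟨
  ind (p 0) + countB (λ z → not (z ≡ᵇ 0) ∧ p z) (upTo (suc n)) ∎
  where
  open ≡-Reasoning
  p₀ = λ z → not (z ≡ᵇ 0) ∧ p z
countB-upTo-split {suc n} {suc a} p (s≤s a<n) = begin
  countB p (upTo (suc n))                                          ≡⟨ countB-upTo-suc n p ⟩
  ind (p 0) + countB (p ∘ suc) (upTo n)                            ≡⟨ cong (ind (p 0) +_) (countB-upTo-split (p ∘ suc) a<n) ⟩
  ind (p 0) + (ind (p (suc a)) + rest)                             ≡⟨ x∙yz≈y∙xz (ind (p 0)) (ind (p (suc a))) rest ⟩
  ind (p (suc a)) + (ind (p 0) + rest)                             ≡⟨ cong (ind (p (suc a)) +_) (countB-upTo-suc n pₐ) ⟨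
  ind (p (suc a)) + countB (λ z → not (z ≡ᵇ suc a) ∧ p z) (upTo (suc n)) ∎
  where
  open ≡-Reasoning
  rest = countB (λ z → not (z ≡ᵇ a) ∧ p (suc z)) (upTo n)
  pₐ = λ z → not (z ≡ᵇ suc a) ∧ p z

countB-allMaps-suc : ∀ m k (p : Vec (Fin k) (suc m) → Bool) →
                     countB p (allMaps (suc m) k) ≡ sum (map (λ y → countB (p ∘ (y ∷_)) (allMaps m k)) (allFin k))
countB-allMaps-suc m k p = trans (countB-concatMap p (λ y → map (y ∷_) (allMaps m k)) (allFin k))
                                 (cong sum (map-cong (λ y → countB-map p (y ∷_) (allMaps m k)) (allFin k)))

data Split (k : ℕ) : ℕ → Set where
  below : ∀ {d} → d < k → Split k d
  above : ∀ e → Split k (k + e)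

split : ∀ k d → Split k d
split zero    d       = above d
split (suc k) zero    = below z<s
split (suc k) (suc d) with split k d
... | below d<k = below (s≤s d<k)
... | above e   = above e

lookupOr : {A : Set} → A → List A → ℕ → A
lookupOr z []       _       = z
lookupOr z (x ∷ xs) zero    = x
lookupOr z (x ∷ xs) (suc i) = lookupOr z xs i

module _ {A : Set} (z : A) where

  lookupOr-++ˡ : ∀ xs {ys i} → i < length xs → lookupOr z (xs ++ ys) i ≡ lookupOr z xs i
  lookupOr-++ˡ (x ∷ xs) {i = zero}  _         = refl
  lookupOr-++ˡ (x ∷ xs) {i = suc i} (s≤s i<m) = lookupOr-++ˡ xs i<m

  lookupOr-++ʳ : ∀ xs {ys} i → lookupOr z (xs ++ ys) (length xs + i) ≡ lookupOr z ys i
  lookupOr-++ʳ []       i = refl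
  lookupOr-++ʳ (x ∷ xs) i = lookupOr-++ʳ xs i

  lookupOr-≥length : ∀ xs {i} → length xs ≤ i → lookupOr z xs i ≡ z
  lookupOr-≥length []       _         = refl
  lookupOr-≥length (x ∷ xs) (s≤s m≤i) = lookupOr-≥length xs m≤i

  lookupOr-∷ʳ : ∀ xs (x : A) → lookupOr z (xs ∷ʳ x) (length xs) ≡ x
  lookupOr-∷ʳ []       x = refl
  lookupOr-∷ʳ (y ∷ xs) x = lookupOr-∷ʳ xs x

  lookupOr-applyUpTo : ∀ (g : ℕ → A) {m i} → i < m → lookupOr z (applyUpTo g m) i ≡ g i
  lookupOr-applyUpTo g {suc m} {zero}  _         = refl
  lookupOr-applyUpTo g {suc m} {suc i} (s≤s i<m) = lookupOr-applyUpTo (g ∘ suc) i<m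

  lookupOr-replicate-++ˡ : ∀ k (x : A) {ys i} → i < k → lookupOr z (replicate k x ++ ys) i ≡ x
  lookupOr-replicate-++ˡ (suc k) x {i = zero}  _         = refl
  lookupOr-replicate-++ˡ (suc k) x {i = suc i} (s≤s i<k) = lookupOr-replicate-++ˡ k x i<k

  lookupOr-replicate-++ʳ : ∀ k (x : A) {ys} i → lookupOr z (replicate k x ++ ys) (k + i) ≡ lookupOr z ys i
  lookupOr-replicate-++ʳ zero    x i = refl
  lookupOr-replicate-++ʳ (suc k) x i = lookupOr-replicate-++ʳ k x i

  lookupOr-map : ∀ {B : Set} (σ : A → B) xs i → lookupOr (σ z) (map σ xs) i ≡ σ (lookupOr z xs i)
  lookupOr-map σ []       i       = refl
  lookupOr-map σ (x ∷ xs) zero    = refl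
  lookupOr-map σ (x ∷ xs) (suc i) = lookupOr-map σ xs i

  applyUpTo-lookupOr : ∀ xs → applyUpTo (lookupOr z xs) (length xs) ≡ xs
  applyUpTo-lookupOr []       = refl
  applyUpTo-lookupOr (x ∷ xs) = cong (x ∷_) (applyUpTo-lookupOr xs)

  lookupOr-reverse : ∀ xs {i} → i < length xs → lookupOr z (reverse xs) i ≡ lookupOr z xs (length xs ∸ suc i)
  lookupOr-reverse (x ∷ xs) {i} i<m rewrite unfold-reverse x xs with m≤n⇒m<n∨m≡n (≤-pred i<m)
  ... | inj₁ i<l = begin
    lookupOr z (reverse xs ∷ʳ x) i                ≡⟨ lookupOr-++ˡ (reverse xs) (subst (i <_) (sym (length-reverse xs)) i<l) ⟩
    lookupOr z (reverse xs) i                     ≡⟨ lookupOr-reverse xs i<l ⟩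
    lookupOr z xs (length xs ∸ suc i)             ≡⟨ cong (lookupOr z (x ∷ xs)) (+-∸-assoc 1 i<l) ⟨
    lookupOr z (x ∷ xs) (suc (length xs) ∸ suc i) ∎
    where open ≡-Reasoning
  ... | inj₂ refl = begin
    lookupOr z (reverse xs ∷ʳ x) (length xs)           ≡⟨ cong (lookupOr z (reverse xs ∷ʳ x)) (length-reverse xs) ⟨
    lookupOr z (reverse xs ∷ʳ x) (length (reverse xs)) ≡⟨ lookupOr-∷ʳ (reverse xs) x ⟩
    x                                                  ≡⟨ cong (lookupOr z (x ∷ xs)) (n∸n≡0 (length xs)) ⟨
    lookupOr z (x ∷ xs) (length xs ∸ length xs)        ∎
    where open ≡-Reasoning

  countB≢0⇒lookupOr : (p : A → Bool) (xs : List A) → countB p xs ≢ 0 → ∃ λ i → T (p (lookupOr z xs i))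
  countB≢0⇒lookupOr p []       ≢0 = ⊥-elim (≢0 refl)
  countB≢0⇒lookupOr p (x ∷ xs) ≢0 with p x in eq
  ... | true  = 0 , Equivalence.from T-≡ eq
  ... | false = let i , t = countB≢0⇒lookupOr p xs ≢0 in suc i , t

InjectiveBelow : ℕ → (ℕ → ℕ) → Set
InjectiveBelow m g = ∀ {i j} → i < m → j < m → g i ≡ g j → i ≡ j

module _ {k : ℕ} where

  app-bounded : ∀ {m} (h : Vec (Fin k) m) {i} → i < m → app h i < k
  app-bounded (y ∷ h) {zero}  _         = toℕ<n y
  app-bounded (y ∷ h) {suc i} (s≤s i<m) = app-bounded h i<m

  injective-∷⁺ : ∀ {m} (y : Fin k) (h : Vec (Fin k) m) →
                 (∀ {i} → i < m → app h i ≢ toℕ y) → InjectiveBelow m (app h) → InjectiveBelow (suc m) (app (y ∷ h))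
  injective-∷⁺ y h fresh injective {zero}  {zero}  _         _         _ = refl
  injective-∷⁺ y h fresh injective {zero}  {suc j} _         (s≤s j<m) e = ⊥-elim (fresh j<m (sym e))
  injective-∷⁺ y h fresh injective {suc i} {zero}  (s≤s i<m) _         e = ⊥-elim (fresh i<m e)
  injective-∷⁺ y h fresh injective {suc i} {suc j} (s≤s i<m) (s≤s j<m) e = cong suc (injective i<m j<m e)

  injective-∷⁻ : ∀ {m} (y : Fin k) (h : Vec (Fin k) m) → InjectiveBelow (suc m) (app (y ∷ h)) →
                 (∀ {i} → i < m → app h i ≢ toℕ y) × InjectiveBelow m (app h)
  injective-∷⁻ y h injective = (λ i<m e → 1+n≢0 (injective (s≤s i<m) z<s e))
                             , (λ i<m j<m e → suc-injective (injective (s≤s i<m) (s≤s j<m) e))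

  preimageSize-self : ∀ {m} (y : Fin k) (h : Vec (Fin k) m) → preimageSize (y ∷ h) (toℕ y) ≡ suc (preimageSize h (toℕ y))
  preimageSize-self y h = cong (λ b → ind b + preimageSize h (toℕ y)) (T-≡true (≡⇒≡ᵇ (toℕ y) (toℕ y) refl))

  preimageSize-hit : ∀ {m} (h : Vec (Fin k) m) {i} → i < m → 1 ≤ preimageSize h (app h i)
  preimageSize-hit (y ∷ h) {zero}  _         = subst (1 ≤_) (sym (preimageSize-self y h)) (s≤s z≤n)
  preimageSize-hit (y ∷ h) {suc i} (s≤s i<m) = ≤-trans (preimageSize-hit h i<m) (m≤n+m _ _)

  preimageSize-witness : ∀ {m} (h : Vec (Fin k) m) w → preimageSize h w ≢ 0 → ∃ λ i → i < m × app h i ≡ w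
  preimageSize-witness []      w ≢0 = ⊥-elim (≢0 refl)
  preimageSize-witness (y ∷ h) w ≢0 with toℕ y ≡ᵇ w in eq
  ... | true  = 0 , z<s , ≡ᵇ⇒≡ _ _ (Equivalence.from T-≡ eq)
  ... | false = let i , i<m , e = preimageSize-witness h w ≢0 in suc i , s≤s i<m , e

  injective⇒preimageSize≤1 : ∀ {m} (h : Vec (Fin k) m) → InjectiveBelow m (app h) → ∀ w → preimageSize h w ≤ 1
  injective⇒preimageSize≤1 []      _         w = z≤n
  injective⇒preimageSize≤1 (y ∷ h) injective w with injective-∷⁻ y h injective | toℕ y ≡ᵇ w in eq
  ... | _ , injective′ | false = injective⇒preimageSize≤1 h injective′ w
  ... | fresh , _      | true with preimageSize h w ≟ 0
  ...   | yes ≡0 = ≤-reflexive (cong suc ≡0)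
  ...   | no  ≢0 = let i , i<m , e = preimageSize-witness h w ≢0 in
                   ⊥-elim (fresh i<m (trans e (sym (≡ᵇ⇒≡ _ _ (Equivalence.from T-≡ eq)))))

  preimageSize≤1⇒injective : ∀ {m} (h : Vec (Fin k) m) → (∀ w → w < k → preimageSize h w ≤ 1) → InjectiveBelow m (app h)
  preimageSize≤1⇒injective []      _  ()
  preimageSize≤1⇒injective (y ∷ h) ≤1 = injective-∷⁺ y h fresh (preimageSize≤1⇒injective h ≤1′)
    where
    ≤1′ : ∀ w → w < k → preimageSize h w ≤ 1
    ≤1′ w w<k = ≤-trans (m≤n+m _ _) (≤1 w w<k)
    fresh : ∀ {i} → i < _ → app h i ≢ toℕ y
    fresh i<m e = <⇒≱ (s≤s (subst (λ w → 1 ≤ preimageSize h w) e (preimageSize-hit h i<m)))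
                      (subst (_≤ 1) (preimageSize-self y h) (≤1 (toℕ y) (toℕ<n y)))

  preimageSizes-sum : ∀ {m} (h : Vec (Fin k) m) → sum (map (preimageSize h) (upTo k)) ≡ m
  preimageSizes-sum []      = sum-map-0 (upTo k)
  preimageSizes-sum (y ∷ h) = begin
    sum (map (preimageSize (y ∷ h)) (upTo k))
      ≡⟨ sum-map-+ (ind ∘ (toℕ y ≡ᵇ_)) (preimageSize h) (upTo k) ⟩
    sum (map (ind ∘ (toℕ y ≡ᵇ_)) (upTo k)) + sum (map (preimageSize h) (upTo k))
      ≡⟨ cong₂ _+_ (trans (sum-map-ind (toℕ y ≡ᵇ_) (upTo k)) (countB-upTo-≡ᵇ (toℕ<n y))) (preimageSizes-sum h) ⟩
    suc _ ∎
    where open ≡-Reasoning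

hasType1n⇔injective : ∀ {n} (h : Vec (Fin n) n) → T (hasType1n h) ⇔ InjectiveBelow n (app h)
hasType1n⇔injective {n} h = mk⇔ (preimageSize≤1⇒injective h ∘ ≤1)
                                (λ inj → all⁻ _ (applyUpTo⁺₁ id n (λ w<n → ≡⇒≡ᵇ _ _ (≡1 inj w<n))))
  where
  ≤1 : T (hasType1n h) → ∀ w → w < n → preimageSize h w ≤ 1
  ≤1 t w w<n = ≤-reflexive (≡ᵇ⇒≡ _ _ (All.lookup (all⁺ _ (upTo n) t) (∈-upTo⁺ w<n)))
  -- the preimage sizes are at most 1 and sum to n, so all of them are 1
  ≡1 : InjectiveBelow n (app h) → ∀ {w} → w < n → preimageSize h w ≡ 1
  ≡1 inj w<n = All.lookup (map⁻ (≤1-sum≡length⇒≡1 (map⁺ (All.universal (injective⇒preimageSize≤1 h inj) (upTo n)))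
                                                 (trans (preimageSizes-sum h) (sym (trans (length-map _ (upTo n)) (length-upTo n))))))
                          (∈-upTo⁺ w<n)

module PathSelfMaps (s : ℕ) (g : ℕ → ℕ) (injective : InjectiveBelow (suc s) g)
                    (step : ∀ i → i < s → g (suc i) ≡ suc (g i) ⊎ g i ≡ suc (g (suc i))) where

  private
    no-turn : ∀ {i} → suc (suc i) ≤ s → g (suc (suc i)) ≢ g i
    no-turn {i} i+2≤s e = <⇒≢ (n≤1+n (suc i)) (injective (s≤s (<⇒≤ (<⇒≤ i+2≤s))) (s≤s i+2≤s) (sym e))

    keeps-ascending : ∀ {i} → suc (suc i) ≤ s → g i ≡ g 0 + i → g (suc i) ≡ g 0 + suc i →
                      g (suc (suc i)) ≡ g 0 + suc (suc i)
    keeps-ascending {i} i+2≤s gᵢ gᵢ₊₁ with step (suc i) i+2≤s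
    ... | inj₁ up   = trans up (trans (cong suc gᵢ₊₁) (sym (+-suc (g 0) (suc i))))
    ... | inj₂ down =
      ⊥-elim (no-turn i+2≤s (suc-injective (trans (sym down) (trans gᵢ₊₁ (trans (+-suc (g 0) i) (cong suc (sym gᵢ)))))))

    keeps-descending : ∀ {i} → suc (suc i) ≤ s → g i + i ≡ g 0 → g (suc i) + suc i ≡ g 0 →
                       g (suc (suc i)) + suc (suc i) ≡ g 0
    keeps-descending {i} i+2≤s gᵢ gᵢ₊₁ with step (suc i) i+2≤s
    ... | inj₂ down = trans (+-suc _ (suc i)) (trans (cong (_+ suc i) (sym down)) gᵢ₊₁)
    ... | inj₁ up   =
      ⊥-elim (no-turn i+2≤s (trans up (sym (+-cancelʳ-≡ i _ _ (trans gᵢ (trans (sym gᵢ₊₁) (+-suc (g (suc i)) i)))))))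

  ascending : g 1 ≡ suc (g 0) → ∀ i → i ≤ s → g i ≡ g 0 + i
  ascending up zero          _     = sym (+-identityʳ (g 0))
  ascending up (suc zero)    _     = trans up (+-comm 1 (g 0))
  ascending up (suc (suc i)) i+2≤s =
    keeps-ascending i+2≤s (ascending up i (<⇒≤ (<⇒≤ i+2≤s))) (ascending up (suc i) (<⇒≤ i+2≤s))

  descending : g 0 ≡ suc (g 1) → ∀ i → i ≤ s → g i + i ≡ g 0
  descending down zero          _     = +-identityʳ (g 0)
  descending down (suc zero)    _     = trans (+-comm (g 1) 1) (sym down)
  descending down (suc (suc i)) i+2≤s =
    keeps-descending i+2≤s (descending down i (<⇒≤ (<⇒≤ i+2≤s))) (descending down (suc i) (<⇒≤ i+2≤s))

  identity-or-reflection : 0 < s → (∀ i → i ≤ s → g i ≤ s) →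
                           (∀ i → i ≤ s → g i ≡ i) ⊎ (∀ i → i ≤ s → g i ≡ s ∸ i)
  identity-or-reflection 0<s into with step 0 0<s
  ... | inj₁ up   = inj₁ λ i i≤s → trans (ascending up i i≤s) (cong (_+ i) g₀≡0)
    where
    g₀≡0 : g 0 ≡ 0
    g₀≡0 = n≤0⇒n≡0 (+-cancelʳ-≤ s (g 0) 0 (subst (_≤ s) (ascending up s ≤-refl) (into s ≤-refl)))
  ... | inj₂ down = inj₂ λ i i≤s → trans (sym (m+n∸n≡m (g i) i)) (cong (_∸ i) (trans (descending down i i≤s) g₀≡s))
    where
    gₛ≡0 : g s ≡ 0
    gₛ≡0 = n≤0⇒n≡0 (+-cancelʳ-≤ s (g s) 0 (subst (_≤ s) (sym (descending down s ≤-refl)) (into 0 z≤n)))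
    g₀≡s : g 0 ≡ s
    g₀≡s = trans (sym (descending down s ≤-refl)) (cong (_+ s) gₛ≡0)

fallingFactorial : ℕ → ℕ → ℕ
fallingFactorial m zero    = 1
fallingFactorial m (suc k) = m * fallingFactorial (m ∸ 1) k

fallingProduct : List ℕ → List ℕ → ℕ
fallingProduct (m ∷ ms) (k ∷ ks) = fallingFactorial m k * fallingProduct ms ks
fallingProduct _        _        = 1

fallingFactorial-self : ∀ k → fallingFactorial k k ≡ k !
fallingFactorial-self zero    = refl
fallingFactorial-self (suc k) = cong (suc k *_) (fallingFactorial-self k)

fallingProduct-self : ∀ f → fallingProduct f f ≡ prodFact f
fallingProduct-self []       = refl
fallingProduct-self (k ∷ ks) = cong₂ _*_ (fallingFactorial-self k) (fallingProduct-self ks)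

fallingFactorial≢0⇒≤ : ∀ m k → fallingFactorial m k ≢ 0 → k ≤ m
fallingFactorial≢0⇒≤ m       zero    _  = z≤n
fallingFactorial≢0⇒≤ zero    (suc k) ≢0 = ⊥-elim (≢0 refl)
fallingFactorial≢0⇒≤ (suc m) (suc k) ≢0 =
  s≤s (fallingFactorial≢0⇒≤ m k (λ e → ≢0 (trans (cong (suc m *_) e) (*-zeroʳ (suc m)))))

fallingProduct≢0⇒≤ : ∀ ms ks → length ms ≡ length ks → fallingProduct ms ks ≢ 0 → Pointwise _≤_ ks ms
fallingProduct≢0⇒≤ []       []       _       _  = []
fallingProduct≢0⇒≤ (m ∷ ms) (k ∷ ks) length≡ ≢0 =
  fallingFactorial≢0⇒≤ m k (λ e → ≢0 (cong (_* fallingProduct ms ks) e)) ∷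
  fallingProduct≢0⇒≤ ms ks (suc-injective length≡)
                     (λ e → ≢0 (trans (cong (fallingFactorial m k *_) e) (*-zeroʳ (fallingFactorial m k))))

pointwise-≤-sum : ∀ {ks ms} → Pointwise _≤_ ks ms → sum ks ≤ sum ms
pointwise-≤-sum []            = z≤n
pointwise-≤-sum (k≤m ∷ ks≤ms) = +-mono-≤ k≤m (pointwise-≤-sum ks≤ms)

pointwise-≤-sum-≡ : ∀ {ks ms} → Pointwise _≤_ ks ms → sum ks ≡ sum ms → ks ≡ ms
pointwise-≤-sum-≡ []                                _ = refl
pointwise-≤-sum-≡ {k ∷ ks} {m ∷ ms} (k≤m ∷ ks≤ms) e =
  cong₂ _∷_ k≡m (pointwise-≤-sum-≡ ks≤ms (+-cancelˡ-≡ m _ _ (trans (cong (_+ sum ks) (sym k≡m)) e)))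
  where
  k≡m : k ≡ m
  k≡m = ≤-antisym k≤m (+-cancelʳ-≤ (sum ms) m k (subst (_≤ k + sum ms) e (+-monoʳ-≤ k (pointwise-≤-sum ks≤ms))))

-- A nonzero product forces fᵢ ≤ fₛ₋ᵢ for every i, and reversal preserves the sum.
fallingProduct-reverse : ∀ f → reverse f ≢ f → fallingProduct (reverse f) f ≡ 0
fallingProduct-reverse f rev≢ with fallingProduct (reverse f) f ≟ 0
... | yes ≡0 = ≡0
... | no  ≢0 = ⊥-elim (rev≢ (sym (pointwise-≤-sum-≡ (fallingProduct≢0⇒≤ (reverse f) f (length-reverse f) ≢0)
                                                   (sym (sum-↭ (↭-reverse f))))))

prodFact+fallingProduct-reverse : ∀ f → prodFact f + fallingProduct (reverse f) f ≡ onePlusPalInd f * prodFact f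
prodFact+fallingProduct-reverse f with ≡-dec _≟_ (reverse f) f
... | yes rev≡ = cong (prodFact f +_) (trans (cong (λ r → fallingProduct r f) rev≡)
                                              (trans (fallingProduct-self f) (sym (+-identityʳ _))))
... | no  rev≢ = cong (prodFact f +_) (fallingProduct-reverse f rev≢)

module Placements {C : Set} (_≟ᶜ_ : DecidableEquality C) where

  takeOne : (C → ℕ) → C → C → ℕ
  takeOne N c d = N d ∸ ind (does (d ≟ᶜ c))

  placements : List C → (C → ℕ) → ℕ
  placements []       N = 1
  placements (c ∷ cs) N = N c * placements cs (takeOne N c)

  placements-cong : ∀ cs {N N′ : C → ℕ} → All (λ d → N d ≡ N′ d) cs → placements cs N ≡ placements cs N′
  placements-cong []       []       = refl
  placements-cong (c ∷ cs) (e ∷ es) =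
    cong₂ _*_ e (placements-cong cs (All.map (λ {d} e′ → cong (_∸ ind (does (d ≟ᶜ c))) e′) es))

  takeOne-other : ∀ N {c d} → d ≢ c → takeOne N c d ≡ N d
  takeOne-other N {c} {d} d≢c = cong (λ b → N d ∸ ind b) (dec-false (d ≟ᶜ c) d≢c)

  placements-replicate-++ : ∀ k c R N → All (_≢ c) R →
                            placements (replicate k c ++ R) N ≡ fallingFactorial (N c) k * placements R N
  placements-replicate-++ zero    c R N _   = sym (+-identityʳ (placements R N))
  placements-replicate-++ (suc k) c R N R≢c = begin
    N c * placements (replicate k c ++ R) N′
      ≡⟨ cong (N c *_) (placements-replicate-++ k c R N′ R≢c) ⟩
    N c * (fallingFactorial (N′ c) k * placements R N′)
      ≡⟨ cong (λ b → N c * (fallingFactorial (N c ∸ ind b) k * placements R N′)) (dec-true (c ≟ᶜ c) refl) ⟩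
    N c * (fallingFactorial (N c ∸ 1) k * placements R N′)
      ≡⟨ cong (λ m → N c * (fallingFactorial (N c ∸ 1) k * m)) (placements-cong R (All.map (takeOne-other N) R≢c)) ⟩
    N c * (fallingFactorial (N c ∸ 1) k * placements R N)
      ≡⟨ *-assoc (N c) _ _ ⟨
    fallingFactorial (N c) (suc k) * placements R N ∎
    where
    open ≡-Reasoning
    N′ = takeOne N c

module ColouredInjections {C : Set} (_≟ᶜ_ : DecidableEquality C) (n : ℕ) (colour : ℕ → C) where
  open Placements _≟ᶜ_

  available : (ℕ → Bool) → C → ℕ
  available free c = countB (λ z → free z ∧ does (c ≟ᶜ colour z)) (upTo n)

  without : (ℕ → Bool) → ℕ → ℕ → Bool
  without free a z = not (z ≡ᵇ a) ∧ free z

  placeable : ∀ {m} → (ℕ → Bool) → List C → Vec (Fin n) m → Bool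
  placeable free []       []      = true
  placeable free (c ∷ cs) (y ∷ h) =
    (free (toℕ y) ∧ does (c ≟ᶜ colour (toℕ y))) ∧ placeable (without free (toℕ y)) cs h
  placeable free _        _       = false

  available-without : ∀ free {a} → a < n → T (free a) → ∀ d →
                      available (without free a) d ≡ takeOne (available free) (colour a) d
  available-without free {a} a<n free-a d = begin
    available (without free a) d          ≡⟨ countB-cong (λ z → ∧-assoc (not (z ≡ᵇ a)) (free z) _) (upTo n) ⟩
    rest                                  ≡⟨ m+n∸m≡n (ind (p a)) rest ⟨
    ind (p a) + rest ∸ ind (p a)          ≡⟨ cong (_∸ ind (p a)) (countB-upTo-split p a<n) ⟨
    available free d ∸ ind (p a)          ≡⟨ cong (λ b → available free d ∸ ind (b ∧ _)) (T-≡true free-a) ⟩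
    takeOne (available free) (colour a) d ∎
    where
    open ≡-Reasoning
    p : ℕ → Bool
    p z = free z ∧ does (d ≟ᶜ colour z)
    rest = countB (λ z → not (z ≡ᵇ a) ∧ p z) (upTo n)

  count-placeable : ∀ cs free → countB (placeable free cs) (allMaps (length cs) n) ≡ placements cs (available free)
  count-placeable []       free = refl
  count-placeable (c ∷ cs) free = begin
    countB (placeable free (c ∷ cs)) (allMaps (suc (length cs)) n)        ≡⟨ countB-allMaps-suc (length cs) n _ ⟩
    sum (map (λ y → countB (λ h → ok (toℕ y) ∧ rest y h) maps) (allFin n)) ≡⟨ cong sum (map-cong per-target (allFin n)) ⟩
    sum (map (λ y → if ok (toℕ y) then K else 0) (allFin n))              ≡⟨ sum-if (ok ∘ toℕ) K (allFin n) ⟩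
    countB (ok ∘ toℕ) (allFin n) * K                                       ≡⟨ cong (_* K) (countB-allFin n ok) ⟩
    available free c * K                                                   ∎
    where
    open ≡-Reasoning
    maps = allMaps (length cs) n
    ok : ℕ → Bool
    ok z = free z ∧ does (c ≟ᶜ colour z)
    rest : Fin n → Vec (Fin n) (length cs) → Bool
    rest y = placeable (without free (toℕ y)) cs
    K = placements cs (takeOne (available free) c)
    placed : ∀ y → T (free (toℕ y)) × T (does (c ≟ᶜ colour (toℕ y))) → countB (rest y) maps ≡ K
    placed y (free-y , c≟colour-y) = trans (count-placeable cs _) (placements-cong cs (All.universal remaining cs))
      where
      remaining : ∀ d → available (without free (toℕ y)) d ≡ takeOne (available free) c d
      remaining d = trans (available-without free (toℕ<n y) free-y d)
                          (cong (λ e → takeOne (available free) e d) (sym (does-sound (c ≟ᶜ _) c≟colour-y)))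
    per-target : ∀ y → countB (λ h → ok (toℕ y) ∧ rest y h) maps ≡ (if ok (toℕ y) then K else 0)
    per-target y = trans (countB-∧ (ok (toℕ y)) (rest y) maps) (if-then-0-cong (ok (toℕ y)) (placed y ∘ Equivalence.to T-∧))

  Placed : ∀ {m} → C → (ℕ → Bool) → List C → Vec (Fin n) m → Set
  Placed {m} z free cs h =
    (∀ i → i < m → T (free (app h i)) × lookupOr z cs i ≡ colour (app h i)) × InjectiveBelow m (app h)

  placeable-sound : ∀ {m} z free cs (h : Vec (Fin n) m) → T (placeable free cs h) → Placed z free cs h
  placeable-sound z free []       []      _ = (λ _ ()) , λ ()
  placeable-sound z free (c ∷ cs) (y ∷ h) t = position , injective-∷⁺ y h fresh (proj₂ placed-tail)
    where
    head-ok = Equivalence.to T-∧ (proj₁ (Equivalence.to T-∧ t))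
    placed-tail = placeable-sound z (without free (toℕ y)) cs h (proj₂ (Equivalence.to T-∧ t))
    tail-ok : ∀ i → i < _ → T (not (app h i ≡ᵇ toℕ y)) × T (free (app h i))
    tail-ok i i<m = Equivalence.to T-∧ (proj₁ (proj₁ placed-tail i i<m))
    position : ∀ i → i < suc _ → T (free (app (y ∷ h) i)) × lookupOr z (c ∷ cs) i ≡ colour (app (y ∷ h) i)
    position zero    _         = proj₁ head-ok , does-sound (c ≟ᶜ _) (proj₂ head-ok)
    position (suc i) (s≤s i<m) = proj₂ (tail-ok i i<m) , proj₂ (proj₁ placed-tail i i<m)
    fresh : ∀ {i} → i < _ → app h i ≢ toℕ y
    fresh {i} i<m e = T-not⇒¬T (proj₁ (tail-ok i i<m)) (≡⇒≡ᵇ _ _ e)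

  placeable-complete : ∀ {m} z free cs (h : Vec (Fin n) m) → length cs ≡ m → Placed z free cs h → T (placeable free cs h)
  placeable-complete z free []       []      _       _                      = _
  placeable-complete z free (c ∷ cs) (y ∷ h) length≡ (position , injective) =
    Equivalence.from T-∧ ( Equivalence.from T-∧ (proj₁ (position 0 z<s) , does-complete (c ≟ᶜ _) (proj₂ (position 0 z<s)))
                         , placeable-complete z (without free (toℕ y)) cs h (suc-injective length≡) (position′ , injective′))
    where
    fresh = proj₁ (injective-∷⁻ y h injective)
    injective′ = proj₂ (injective-∷⁻ y h injective)
    position′ : ∀ i → i < _ → T (without free (toℕ y) (app h i)) × lookupOr z cs i ≡ colour (app h i)
    position′ i i<m = Equivalence.from T-∧ (¬T⇒T-not (fresh i<m ∘ ≡ᵇ⇒≡ _ _) , proj₁ (position (suc i) (s≤s i<m)))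
                    , proj₂ (position (suc i) (s≤s i<m))

-- Labels ≥ n, which are not vertices, get the colour none.
data Colour : Set where
  spine leaf : ℕ → Colour
  none       : Colour

spine-injective : ∀ {i j} → spine i ≡ spine j → i ≡ j
spine-injective refl = refl

leaf-injective : ∀ {i j} → leaf i ≡ leaf j → i ≡ j
leaf-injective refl = refl

_≟ᶜ_ : DecidableEquality Colour
spine i ≟ᶜ spine j = map′ (cong spine) spine-injective (i ≟ j)
leaf i  ≟ᶜ leaf j  = map′ (cong leaf) leaf-injective (i ≟ j)
none    ≟ᶜ none    = yes refl
spine _ ≟ᶜ leaf _  = no λ ()
spine _ ≟ᶜ none    = no λ ()
leaf _  ≟ᶜ spine _ = no λ ()
leaf _  ≟ᶜ none    = no λ ()
none    ≟ᶜ spine _ = no λ ()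
none    ≟ᶜ leaf _  = no λ ()

open Placements _≟ᶜ_

relabel : (ℕ → ℕ) → Colour → Colour
relabel τ (spine j) = spine (τ j)
relabel τ (leaf j)  = leaf (τ j)
relabel τ none      = none

relabel-id : ∀ c → relabel id c ≡ c
relabel-id (spine j) = refl
relabel-id (leaf j)  = refl
relabel-id none      = refl

IsLeaf : Colour → Set
IsLeaf c = ∃ λ j → c ≡ leaf j

multiplicity : List Colour → Colour → ℕ
multiplicity cs c = countB (λ e → does (c ≟ᶜ e)) cs

leafColours : (ℕ → ℕ) → List ℕ → List Colour
leafColours τ []       = []
leafColours τ (k ∷ ks) = replicate k (leaf (τ 0)) ++ leafColours (τ ∘ suc) ks

layout : List ℕ → List Colour
layout f = applyUpTo spine (length f) ++ leafColours id f

length-leafColours : ∀ τ ks → length (leafColours τ ks) ≡ sum ks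
length-leafColours τ []       = refl
length-leafColours τ (k ∷ ks) =
  trans (length-++ (replicate k _)) (cong₂ _+_ (length-replicate k) (length-leafColours (τ ∘ suc) ks))

length-layout : ∀ f → length (layout f) ≡ numVertices f
length-layout f = trans (length-++ (applyUpTo spine (length f)))
                        (cong₂ _+_ (length-applyUpTo spine (length f)) (length-leafColours id f))

All-leafColours : ∀ {P : Colour → Set} τ ks → (∀ t → t < length ks → P (leaf (τ t))) → All P (leafColours τ ks)
All-leafColours τ []       _ = []
All-leafColours τ (k ∷ ks) p = ++⁺ (replicate⁺ k (p 0 z<s)) (All-leafColours (τ ∘ suc) ks (λ t t<m → p (suc t) (s≤s t<m)))

map-relabel-leafColours : ∀ ρ τ ks → map (relabel ρ) (leafColours τ ks) ≡ leafColours (ρ ∘ τ) ks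
map-relabel-leafColours ρ τ []       = refl
map-relabel-leafColours ρ τ (k ∷ ks) = trans (map-++ (relabel ρ) (replicate k _) _)
  (cong₂ _++_ (map-replicate (relabel ρ) k _) (map-relabel-leafColours ρ (τ ∘ suc) ks))

lookupOr-leafColours : ∀ τ ks {d} → d < sum ks → ∃ λ t → t < length ks × lookupOr none (leafColours τ ks) d ≡ leaf (τ t)
lookupOr-leafColours τ (k ∷ ks) {d} d<sum with split k d
... | below d<k = 0 , z<s , lookupOr-replicate-++ˡ none k _ d<k
... | above e   = let t , t<m , eq = lookupOr-leafColours (τ ∘ suc) ks (+-cancelˡ-< k e (sum ks) d<sum) in
                  suc t , s≤s t<m , trans (lookupOr-replicate-++ʳ none k _ e) eq

multiplicity-leafColours-spine : ∀ τ ks j → multiplicity (leafColours τ ks) (spine j) ≡ 0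
multiplicity-leafColours-spine τ ks j = countB-none (All-leafColours τ ks (λ _ _ ()))

multiplicity-leafColours : ∀ τ ks {t} → InjectiveBelow (length ks) τ → t < length ks →
                           multiplicity (leafColours τ ks) (leaf (τ t)) ≡ lookupOr 0 ks t
multiplicity-leafColours τ (k ∷ ks) {zero} inj _ =
  trans (countB-++ p (replicate k (leaf (τ 0))) _)
        (trans (cong₂ _+_ (countB-replicate k (does-complete (leaf (τ 0) ≟ᶜ leaf (τ 0)) refl))
                          (countB-none (All-leafColours (τ ∘ suc) ks absent)))
               (+-identityʳ k))
  where
  p = λ e → does (leaf (τ 0) ≟ᶜ e)
  absent : ∀ t → t < length ks → ¬ T (p (leaf (τ (suc t))))
  absent t t<m eq = 0≢1+n (inj z<s (s≤s t<m) (leaf-injective (does-sound (leaf _ ≟ᶜ leaf _) eq)))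
multiplicity-leafColours τ (k ∷ ks) {suc t} inj (s≤s t<m) =
  trans (countB-++ p (replicate k (leaf (τ 0))) _)
        (cong₂ _+_ (countB-none (replicate⁺ k different))
                   (multiplicity-leafColours (τ ∘ suc) ks (λ i<m j<m e → suc-injective (inj (s≤s i<m) (s≤s j<m) e)) t<m))
  where
  p = λ e → does (leaf (τ (suc t)) ≟ᶜ e)
  different : ¬ T (p (leaf (τ 0)))
  different eq = 1+n≢0 (inj (s≤s t<m) z<s (leaf-injective (does-sound (leaf _ ≟ᶜ leaf _) eq)))

placements-spine-++ : ∀ m τ R N → InjectiveBelow m τ → (∀ j → j < m → N (spine (τ j)) ≡ 1) → All IsLeaf R →
                      placements (applyUpTo (spine ∘ τ) m ++ R) N ≡ placements R N
placements-spine-++ zero    τ R N _   _   _      = refl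
placements-spine-++ (suc m) τ R N inj N≡1 leaves = begin
  N (spine (τ 0)) * placements (applyUpTo (spine ∘ τ ∘ suc) m ++ R) N′
    ≡⟨ cong (_* placements (applyUpTo (spine ∘ τ ∘ suc) m ++ R) N′) (N≡1 0 z<s) ⟩
  1 * placements (applyUpTo (spine ∘ τ ∘ suc) m ++ R) N′
    ≡⟨ *-identityˡ _ ⟩
  placements (applyUpTo (spine ∘ τ ∘ suc) m ++ R) N′
    ≡⟨ placements-spine-++ m (τ ∘ suc) R N′ inj′ N′≡1 leaves ⟩
  placements R N′
    ≡⟨ placements-cong R (All.map (λ { (j , refl) → takeOne-other N {spine (τ 0)} λ () }) leaves) ⟩
  placements R N ∎
  where
  open ≡-Reasoning
  N′ = takeOne N (spine (τ 0))
  inj′ : InjectiveBelow m (τ ∘ suc)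
  inj′ i<m j<m e = suc-injective (inj (s≤s i<m) (s≤s j<m) e)
  N′≡1 : ∀ j → j < m → N′ (spine (τ (suc j))) ≡ 1
  N′≡1 j j<m = trans (takeOne-other N (λ e → 1+n≢0 (inj (s≤s j<m) z<s (spine-injective e)))) (N≡1 (suc j) (s≤s j<m))

placements-leafColours : ∀ τ ks ms N → length ms ≡ length ks → InjectiveBelow (length ks) τ →
                         (∀ t → t < length ks → N (leaf (τ t)) ≡ lookupOr 0 ms t) →
                         placements (leafColours τ ks) N ≡ fallingProduct ms ks
placements-leafColours τ []       []       N _       _   _  = refl
placements-leafColours τ (k ∷ ks) (m ∷ ms) N length≡ inj N≡ = begin
  placements (replicate k (leaf (τ 0)) ++ leafColours (τ ∘ suc) ks) N
    ≡⟨ placements-replicate-++ k _ _ N (All-leafColours (τ ∘ suc) ks other) ⟩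
  fallingFactorial (N (leaf (τ 0))) k * placements (leafColours (τ ∘ suc) ks) N
    ≡⟨ cong₂ (λ a b → fallingFactorial a k * b) (N≡ 0 z<s)
             (placements-leafColours (τ ∘ suc) ks ms N (suc-injective length≡) inj′ (λ t t<m → N≡ (suc t) (s≤s t<m))) ⟩
  fallingFactorial m k * fallingProduct ms ks ∎
  where
  open ≡-Reasoning
  inj′ : InjectiveBelow (length ks) (τ ∘ suc)
  inj′ i<m j<m e = suc-injective (inj (s≤s i<m) (s≤s j<m) e)
  other : ∀ t → t < length ks → leaf (τ (suc t)) ≢ leaf (τ 0)
  other t t<m e = 1+n≢0 (inj (s≤s t<m) z<s (leaf-injective e))

∈-spineEdges⁻ : ∀ s {x y} → (x , y) ∈ spineEdges s → x < s × y ≡ suc x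
∈-spineEdges⁻ s xy∈ with ∈-map⁻ (λ i → (i , suc i)) xy∈
... | i , i∈ , refl = ∈-upTo⁻ i∈ , refl

∈-spineEdges⁺ : ∀ s {x} → x < s → (x , suc x) ∈ spineEdges s
∈-spineEdges⁺ s x<s = ∈-map⁺ (λ i → (i , suc i)) (∈-upTo⁺ x<s)

∈-leafEdges⁻ : ∀ i c ks {τ x y} → (∀ t → τ t ≡ i + t) → (x , y) ∈ leafEdges i c ks →
               ∃ λ d → y ≡ c + d × lookupOr none (leafColours τ ks) d ≡ leaf x
∈-leafEdges⁻ i c (k ∷ ks) {τ} τ≗ xy∈ with ∈-++⁻ (map (λ j → (i , c + j)) (upTo k)) xy∈
... | inj₁ xy∈ʰ with ∈-map⁻ (λ j → (i , c + j)) xy∈ʰ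
...   | d , d∈ , refl =
  d , refl , trans (lookupOr-replicate-++ˡ none k _ (∈-upTo⁻ d∈)) (cong leaf (trans (τ≗ 0) (+-identityʳ i)))
∈-leafEdges⁻ i c (k ∷ ks) {τ} τ≗ xy∈ | inj₂ xy∈ᵗ
  with ∈-leafEdges⁻ (suc i) (c + k) ks (λ t → trans (τ≗ (suc t)) (+-suc i t)) xy∈ᵗ
... | d , refl , eq = k + d , +-assoc c k d , trans (lookupOr-replicate-++ʳ none k _ d) eq

∈-leafEdges⁺ : ∀ i c ks {τ x} d → (∀ t → τ t ≡ i + t) → lookupOr none (leafColours τ ks) d ≡ leaf x →
               (x , c + d) ∈ leafEdges i c ks
∈-leafEdges⁺ i c (k ∷ ks) {τ} d τ≗ eq with split k d
... | below d<k with trans (sym (lookupOr-replicate-++ˡ none k _ d<k)) eq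
...   | refl rewrite τ≗ 0 | +-identityʳ i = ∈-++⁺ˡ (∈-map⁺ (λ j → (i , c + j)) (∈-upTo⁺ d<k))
∈-leafEdges⁺ i c (k ∷ ks) {τ} {x} _ τ≗ eq | above e =
  ∈-++⁺ʳ (map (λ j → (i , c + j)) (upTo k))
    (subst (λ y → (x , y) ∈ leafEdges (suc i) (c + k) ks) (+-assoc c k e)
      (∈-leafEdges⁺ (suc i) (c + k) ks e (λ t → trans (τ≗ (suc t)) (+-suc i t))
                    (trans (sym (lookupOr-replicate-++ʳ none k _ e)) eq)))

module Caterpillar (f : List ℕ) where

  L s n : ℕ
  L = length f
  s = L ∸ 1
  n = numVertices f

  colour : ℕ → Colour
  colour = lookupOr none (layout f)

  colour-spine : ∀ {x} → x < L → colour x ≡ spine x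
  colour-spine x<L = trans (lookupOr-++ˡ none (applyUpTo spine L) (subst (_ <_) (sym (length-applyUpTo spine L)) x<L))
                           (lookupOr-applyUpTo none spine x<L)

  colour-leafRegion : ∀ d → colour (L + d) ≡ lookupOr none (leafColours id f) d
  colour-leafRegion d = trans (cong (λ m → colour (m + d)) (sym (length-applyUpTo spine L)))
                              (lookupOr-++ʳ none (applyUpTo spine L) d)

  data VertexKind (x : ℕ) : Set where
    spineVertex : x < L → VertexKind x
    leafVertex  : ∀ {j} → L ≤ x → x < n → j < L → colour x ≡ leaf j → VertexKind x
    nonVertex   : n ≤ x → colour x ≡ none → VertexKind x

  vertexKind : ∀ x → VertexKind x
  vertexKind x with split L x
  ... | below x<L = spineVertex x<L
  ... | above d with split (sum f) d
  ...   | below d<sum = let j , j<L , eq = lookupOr-leafColours id f d<sum in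
                        leafVertex (m≤m+n L d) (+-monoʳ-< L d<sum) j<L (trans (colour-leafRegion d) eq)
  ...   | above e     = nonVertex (+-monoʳ-≤ L (m≤m+n (sum f) e))
                                  (trans (colour-leafRegion (sum f + e))
                                         (lookupOr-≥length none (leafColours id f)
                                           (subst (_≤ sum f + e) (sym (length-leafColours id f)) (m≤m+n _ e))))

  colour≡spine⇒ : ∀ {x j} → colour x ≡ spine j → x ≡ j
  colour≡spine⇒ {x} eq with vertexKind x
  ... | spineVertex x<L      = spine-injective (trans (sym (colour-spine x<L)) eq)
  ... | leafVertex _ _ _ eq′ = case trans (sym eq′) eq of λ ()
  ... | nonVertex _ eq′      = case trans (sym eq′) eq of λ ()

  colour≡leaf⇒ : ∀ {x j} → colour x ≡ leaf j → L ≤ x × x < n × j < L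
  colour≡leaf⇒ {x} eq with vertexKind x
  ... | spineVertex x<L = case trans (sym (colour-spine x<L)) eq of λ ()
  ... | nonVertex _ eq′ = case trans (sym eq′) eq of λ ()
  ... | leafVertex L≤x x<n j<L eq′ with leaf-injective (trans (sym eq′) eq)
  ...   | refl = L≤x , x<n , j<L

  colour-leaf : ∀ {x} → L ≤ x → x < n → ∃ λ j → colour x ≡ leaf j
  colour-leaf {x} L≤x x<n with vertexKind x
  ... | spineVertex x<L     = ⊥-elim (<⇒≱ x<L L≤x)
  ... | leafVertex _ _ _ eq = _ , eq
  ... | nonVertex n≤x _     = ⊥-elim (<⇒≱ x<n n≤x)

  Edge : ℕ → ℕ → Set
  Edge x y = (x < s × y ≡ suc x) ⊎ colour y ≡ leaf x

  Adj : ℕ → ℕ → Set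
  Adj u v = Edge u v ⊎ Edge v u

  IsHom : (ℕ → ℕ) → Set
  IsHom g = ∀ {x y} → Edge x y → Adj (g x) (g y)

  ∈-edges⁻ : ∀ {x y} → (x , y) ∈ edges f → Edge x y
  ∈-edges⁻ xy∈ with ∈-++⁻ (spineEdges s) xy∈
  ... | inj₁ xy∈ˢ = inj₁ (∈-spineEdges⁻ s xy∈ˢ)
  ... | inj₂ xy∈ˡ with ∈-leafEdges⁻ 0 L f (λ _ → refl) xy∈ˡ
  ...   | d , refl , eq = inj₂ (trans (colour-leafRegion d) eq)

  ∈-edges⁺ : ∀ {x y} → Edge x y → (x , y) ∈ edges f
  ∈-edges⁺ (inj₁ (x<s , refl)) = ∈-++⁺ˡ (∈-spineEdges⁺ s x<s)
  ∈-edges⁺ {x} {y} (inj₂ eq) with split L y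
  ... | below y<L = ⊥-elim (<⇒≱ y<L (proj₁ (colour≡leaf⇒ eq)))
  ... | above d   = ∈-++⁺ʳ (spineEdges s) (∈-leafEdges⁺ 0 L f d (λ _ → refl) (trans (sym (colour-leafRegion d)) eq))

  adj⇔Adj : ∀ u v → T (adj f u v) ⇔ Adj u v
  adj⇔Adj u v = mk⇔ to from
    where
    to : T (adj f u v) → Adj u v
    to t with find (any⁻ _ (edges f) t)
    ... | (x , y) , xy∈ , t′ with Equivalence.to T-∨ t′
    ...   | inj₁ t″ with Equivalence.to T-∧ t″
    ...     | u≡ᵇx , v≡ᵇy with ≡ᵇ⇒≡ u x u≡ᵇx | ≡ᵇ⇒≡ v y v≡ᵇy
    ...       | refl | refl = inj₁ (∈-edges⁻ xy∈)
    to t | (x , y) , xy∈ , t′ | inj₂ t″ with Equivalence.to T-∧ t″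
    ...     | u≡ᵇy , v≡ᵇx with ≡ᵇ⇒≡ u y u≡ᵇy | ≡ᵇ⇒≡ v x v≡ᵇx
    ...       | refl | refl = inj₂ (∈-edges⁻ xy∈)
    matches : T ((u ≡ᵇ u) ∧ (v ≡ᵇ v))
    matches = Equivalence.from T-∧ (≡⇒≡ᵇ u u refl , ≡⇒≡ᵇ v v refl)
    from : Adj u v → T (adj f u v)
    from (inj₁ e) = any⁺ _ (lose (∈-edges⁺ e) (Equivalence.from T-∨ (inj₁ matches)))
    from (inj₂ e) = any⁺ _ (lose (∈-edges⁺ e) (Equivalence.from T-∨ (inj₂ matches)))

  isHom⇔IsHom : (h : Vec (Fin n) n) → T (isHom f h) ⇔ IsHom (app h)
  isHom⇔IsHom h =
    mk⇔ (λ t {x} {y} e → Equivalence.to (adj⇔Adj _ _) (All.lookup (all⁺ _ (edges f) t) (∈-edges⁺ e)))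
        (λ hom → all⁻ _ {xs = edges f}
                   (All.tabulate λ { {x , y} xy∈ → Equivalence.from (adj⇔Adj _ _) (hom (∈-edges⁻ xy∈)) }))

module Automorphisms (f₀ : ℕ) (rest : List ℕ) (0<s : 0 < length rest)
                     (f₀≥1 : 1 ≤ f₀) (fₛ≥1 : 1 ≤ lookupOr 0 (f₀ ∷ rest) (length rest)) where

  f : List ℕ
  f = f₀ ∷ rest

  open Caterpillar f
  open ColouredInjections _≟ᶜ_ n colour

  L≤n : L ≤ n
  L≤n = m≤m+n L (sum f)

  multiplicity-spine : ∀ {j} → j < L → multiplicity (layout f) (spine j) ≡ 1
  multiplicity-spine {j} j<L =
    trans (countB-++ (λ e → does (spine j ≟ᶜ e)) (applyUpTo spine L) _)
          (cong₂ _+_ onSpine (multiplicity-leafColours-spine id f j))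
    where
    onSpine : multiplicity (applyUpTo spine L) (spine j) ≡ 1
    onSpine = trans (cong (λ cs → multiplicity cs (spine j)) (sym (map-upTo spine L)))
                    (trans (countB-map (λ e → does (spine j ≟ᶜ e)) spine (upTo L)) (countB-upTo-≡ᵇ j<L))

  multiplicity-leaf : ∀ {t} → t < L → multiplicity (layout f) (leaf t) ≡ lookupOr 0 f t
  multiplicity-leaf {t} t<L =
    trans (countB-++ (λ e → does (leaf t ≟ᶜ e)) (applyUpTo spine L) _)
          (cong₂ _+_ onSpine (multiplicity-leafColours id f (λ _ _ e → e) t<L))
    where
    onSpine : multiplicity (applyUpTo spine L) (leaf t) ≡ 0
    onSpine = trans (cong (λ cs → multiplicity cs (leaf t)) (sym (map-upTo spine L)))
                    (trans (countB-map (λ e → does (leaf t ≟ᶜ e)) spine (upTo L)) (countB-false (upTo L)))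

  available≡multiplicity : ∀ c → available (λ _ → true) c ≡ multiplicity (layout f) c
  available≡multiplicity c = begin
    countB ((λ e → does (c ≟ᶜ e)) ∘ colour) (upTo n)      ≡⟨ countB-map (λ e → does (c ≟ᶜ e)) colour (upTo n) ⟨
    multiplicity (map colour (upTo n)) c                  ≡⟨ cong (λ cs → multiplicity cs c) (map-upTo colour n) ⟩
    multiplicity (applyUpTo colour n) c                   ≡⟨ cong (λ m → multiplicity (applyUpTo colour m) c) (length-layout f) ⟨
    multiplicity (applyUpTo colour (length (layout f))) c ≡⟨ cong (λ cs → multiplicity cs c) (applyUpTo-lookupOr none (layout f)) ⟩
    multiplicity (layout f) c                             ∎
    where open ≡-Reasoning

  leafAt : ∀ {j} → 1 ≤ lookupOr 0 f j → j < L → ∃ λ y → colour y ≡ leaf j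
  leafAt {j} fⱼ≥1 j<L =
    let y , t = countB≢0⇒lookupOr none (λ e → does (leaf j ≟ᶜ e)) (layout f)
                                  (λ e → <⇒≢ fⱼ≥1 (sym (trans (sym (multiplicity-leaf j<L)) e))) in
    y , sym (does-sound (leaf j ≟ᶜ colour y) t)

  Adj-sym : ∀ {u v} → Adj u v → Adj v u
  Adj-sym (inj₁ e) = inj₂ e
  Adj-sym (inj₂ e) = inj₁ e

  leafNeighbour : ∀ {u v j} → colour u ≡ leaf j → Adj u v → v ≡ j
  leafNeighbour {u} {v} eq adj with colour≡leaf⇒ {u} eq
  ... | L≤u , _ , _ with adj
  ...   | inj₁ (inj₁ (u<s , _))    = ⊥-elim (<⇒≱ (m<n⇒m<1+n u<s) L≤u)
  ...   | inj₁ (inj₂ eq′)          = ⊥-elim (<⇒≱ (proj₂ (proj₂ (colour≡leaf⇒ {v} eq′))) L≤u)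
  ...   | inj₂ (inj₁ (v<s , refl)) = ⊥-elim (<⇒≱ (s≤s v<s) L≤u)
  ...   | inj₂ (inj₂ eq′)          = leaf-injective (trans (sym eq′) eq)

  spineNeighbours : ∀ {u v} → u < L → v < L → Adj u v → v ≡ suc u ⊎ u ≡ suc v
  spineNeighbours u<L v<L (inj₁ (inj₁ (_ , v≡))) = inj₁ v≡
  spineNeighbours u<L v<L (inj₂ (inj₁ (_ , u≡))) = inj₂ u≡
  spineNeighbours u<L v<L (inj₁ (inj₂ eq))       = case trans (sym (colour-spine v<L)) eq of λ ()
  spineNeighbours u<L v<L (inj₂ (inj₂ eq))       = case trans (sym (colour-spine u<L)) eq of λ ()

  spineLeafNeighbour : ∀ {u v} → u < L → L ≤ v → Adj u v → colour v ≡ leaf u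
  spineLeafNeighbour u<L L≤v (inj₁ (inj₁ (u<s , refl))) = ⊥-elim (<⇒≱ (s≤s u<s) L≤v)
  spineLeafNeighbour u<L L≤v (inj₁ (inj₂ eq))           = eq
  spineLeafNeighbour u<L L≤v (inj₂ (inj₁ (v<s , _)))    = ⊥-elim (<⇒≱ (m<n⇒m<1+n v<s) L≤v)
  spineLeafNeighbour u<L L≤v (inj₂ (inj₂ eq))           = case trans (sym (colour-spine u<L)) eq of λ ()

  twoNeighbours : ∀ {x} → x < L → ∃ λ a → ∃ λ b → a < n × b < n × a ≢ b × Adj x a × Adj x b
  twoNeighbours {zero} _ =
    let y , eq = leafAt f₀≥1 z<s
        L≤y , y<n , _ = colour≡leaf⇒ eq in
    1 , y , ≤-trans (s≤s 0<s) L≤n , y<n , (λ e → <⇒≱ (s≤s 0<s) (subst (L ≤_) (sym e) L≤y)) ,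
    inj₁ (inj₁ (0<s , refl)) , inj₁ (inj₂ eq)
  twoNeighbours {suc x} (s≤s x<s) with m≤n⇒m<n∨m≡n x<s
  ... | inj₁ x+1<s = x , suc (suc x) , ≤-trans (m<n⇒m<1+n x<s) L≤n , ≤-trans (s≤s x+1<s) L≤n ,
                     <⇒≢ (n≤1+n _) , inj₂ (inj₁ (x<s , refl)) , inj₁ (inj₁ (x+1<s , refl))
  ... | inj₂ x+1≡s =
    let y , eq = leafAt fₛ≥1 ≤-refl
        L≤y , y<n , _ = colour≡leaf⇒ eq in
    x , y , ≤-trans (m<n⇒m<1+n x<s) L≤n , y<n , (λ e → <⇒≱ (m<n⇒m<1+n x<s) (subst (L ≤_) (sym e) L≤y)) ,
    inj₂ (inj₁ (x<s , refl)) , inj₁ (inj₂ (trans eq (cong leaf (sym x+1≡s))))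

  Respects : (ℕ → ℕ) → (ℕ → ℕ) → Set
  Respects τ g = ∀ {x} → x < n → colour (g x) ≡ relabel τ (colour x)

  reflect : ℕ → ℕ
  reflect i = s ∸ i

  module Forward (g : ℕ → ℕ) (hom : IsHom g) (injective : InjectiveBelow n g) (bounded : ∀ {x} → x < n → g x < n) where

    hom-Adj : ∀ {x y} → Adj x y → Adj (g x) (g y)
    hom-Adj (inj₁ e) = hom e
    hom-Adj (inj₂ e) = Adj-sym (hom e)

    -- the two distinct neighbours of a spine vertex cannot both go to the only neighbour of a leaf
    spine↦spine : ∀ {x} → x < L → g x < L
    spine↦spine {x} x<L with g x <? L
    ... | yes gx<L = gx<L
    ... | no  gx≮L with colour-leaf {g x} (≮⇒≥ gx≮L) (bounded (≤-trans x<L L≤n))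
    ...   | j , eq with twoNeighbours x<L
    ...     | a , b , a<n , b<n , a≢b , xa , xb =
      ⊥-elim (a≢b (injective a<n b<n (trans (leafNeighbour eq (hom-Adj xa)) (sym (leafNeighbour eq (hom-Adj xb))))))

    spine-step : ∀ i → i < s → g (suc i) ≡ suc (g i) ⊎ g i ≡ suc (g (suc i))
    spine-step i i<s = spineNeighbours (spine↦spine (m<n⇒m<1+n i<s)) (spine↦spine (s≤s i<s)) (hom (inj₁ (i<s , refl)))

    respects : ∀ τ → (∀ {i} → i < L → τ i < L) → (∀ {k} → k < L → ∃ λ i → i < L × τ i ≡ k) →
               (∀ {i} → i < L → g i ≡ τ i) → Respects τ g
    respects τ τ< τ-onto g≡τ {x} x<n with split L x
    ... | below x<L = trans (cong colour (g≡τ x<L)) (trans (colour-spine (τ< x<L)) (cong (relabel τ) (sym (colour-spine x<L))))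
    ... | above d with colour-leaf {L + d} (m≤m+n L d) x<n
    ...   | j , eq = trans (spineLeafNeighbour (τ< j<L) L≤gx (subst (λ w → Adj w (g x)) (g≡τ j<L) (hom (inj₂ eq))))
                           (cong (relabel τ) (sym eq))
      where
      j<L = proj₂ (proj₂ (colour≡leaf⇒ {L + d} eq))
      L≤gx : L ≤ g (L + d)
      L≤gx with g (L + d) <? L
      ... | no  gx≮L = ≮⇒≥ gx≮L
      ... | yes gx<L =
        let i , i<L , τi≡gx = τ-onto gx<L in
        ⊥-elim (<⇒≱ i<L (subst (L ≤_) (sym (injective (≤-trans i<L L≤n) x<n (trans (g≡τ i<L) τi≡gx))) (m≤m+n L d)))

    identity-or-reflection : Respects id g ⊎ Respects reflect g
    identity-or-reflection
      with PathSelfMaps.identity-or-reflection s g (λ i<L j<L → injective (≤-trans i<L L≤n) (≤-trans j<L L≤n)) spine-step 0<s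
                                               (λ i i≤s → ≤-pred (spine↦spine (s≤s i≤s)))
    ... | inj₁ g≡id      = inj₁ (respects id id (λ {k} k<L → k , k<L , refl) (λ {i} i<L → g≡id i (≤-pred i<L)))
    ... | inj₂ g≡reflect = inj₂ (respects reflect (λ {i} _ → s≤s (m∸n≤m s i))
                                          (λ {k} k<L → s ∸ k , s≤s (m∸n≤m s k) , m∸[m∸n]≡n (≤-pred k<L))
                                          (λ {i} i<L → g≡reflect i (≤-pred i<L)))

  respects⇒IsHom : ∀ τ → (∀ {i} → i < s → Adj (τ i) (τ (suc i))) → ∀ {g} → Respects τ g → IsHom g
  respects⇒IsHom τ τ-adj {g} resp = hom
    where
    onSpine : ∀ {i} → i < L → g i ≡ τ i
    onSpine {i} i<L = colour≡spine⇒ {g i} (trans (resp (≤-trans i<L L≤n)) (cong (relabel τ) (colour-spine i<L)))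
    hom : IsHom g
    hom (inj₁ (x<s , refl)) = subst₂ Adj (sym (onSpine (m<n⇒m<1+n x<s))) (sym (onSpine (s≤s x<s))) (τ-adj x<s)
    hom {x} {y} (inj₂ eq) =
      let _ , y<n , x<L = colour≡leaf⇒ {y} eq in
      inj₁ (inj₂ (trans (resp y<n) (trans (cong (relabel τ) eq) (cong leaf (sym (onSpine x<L))))))

  id-Adj : ∀ {i} → i < s → Adj i (suc i)
  id-Adj i<s = inj₁ (inj₁ (i<s , refl))

  reflect-Adj : ∀ {i} → i < s → Adj (reflect i) (reflect (suc i))
  reflect-Adj {i} i<s = inj₂ (inj₁ (subst (_≤ s) s∸i≡ (m∸n≤m s i) , s∸i≡))
    where
    s∸i≡ : s ∸ i ≡ suc (s ∸ suc i)
    s∸i≡ = +-∸-assoc 1 i<s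

  fits : (ℕ → ℕ) → Vec (Fin n) n → Bool
  fits τ = placeable (λ _ → true) (map (relabel τ) (layout f))

  length-relabelled : ∀ τ → length (map (relabel τ) (layout f)) ≡ n
  length-relabelled τ = trans (length-map (relabel τ) (layout f)) (length-layout f)

  fits⇔ : ∀ τ h → T (fits τ h) ⇔ (Respects τ (app h) × InjectiveBelow n (app h))
  fits⇔ τ h = mk⇔ to from
    where
    cs = map (relabel τ) (layout f)
    lookup-cs : ∀ i → lookupOr none cs i ≡ relabel τ (colour i)
    lookup-cs = lookupOr-map none (relabel τ) (layout f)
    to : T (fits τ h) → Respects τ (app h) × InjectiveBelow n (app h)
    to t = let placed , inj = placeable-sound none (λ _ → true) cs h t in
           (λ {x} x<n → trans (sym (proj₂ (placed x x<n))) (lookup-cs x)) , inj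
    from : Respects τ (app h) × InjectiveBelow n (app h) → T (fits τ h)
    from (resp , inj) = placeable-complete none (λ _ → true) cs h (length-relabelled τ)
                          ((λ x x<n → _ , trans (lookup-cs x) (sym (resp x<n))) , inj)

  isAutomorphism⇔fits : ∀ h → T (isHom f h ∧ hasType1n h) ⇔ T (fits id h ∨ fits reflect h)
  isAutomorphism⇔fits h = mk⇔ to from
    where
    to : T (isHom f h ∧ hasType1n h) → T (fits id h ∨ fits reflect h)
    to t with Equivalence.to T-∧ t
    ... | hom , type with Equivalence.to (hasType1n⇔injective h) type
    ...   | inj with Forward.identity-or-reflection (app h) (Equivalence.to (isHom⇔IsHom h) hom) inj (app-bounded h)
    ...     | inj₁ r = Equivalence.from T-∨ (inj₁ (Equivalence.from (fits⇔ id h) (r , inj)))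
    ...     | inj₂ r = Equivalence.from T-∨ (inj₂ (Equivalence.from (fits⇔ reflect h) (r , inj)))
    automorphism : ∀ τ → (∀ {i} → i < s → Adj (τ i) (τ (suc i))) → T (fits τ h) → T (isHom f h ∧ hasType1n h)
    automorphism τ τ-adj t =
      let r , inj = Equivalence.to (fits⇔ τ h) t in
      Equivalence.from T-∧ ( Equivalence.from (isHom⇔IsHom h) (respects⇒IsHom τ τ-adj r)
                           , Equivalence.from (hasType1n⇔injective h) inj)
    from : T (fits id h ∨ fits reflect h) → T (isHom f h ∧ hasType1n h)
    from t with Equivalence.to T-∨ t
    ... | inj₁ t′ = automorphism id id-Adj t′
    ... | inj₂ t′ = automorphism reflect reflect-Adj t′

  fits-disjoint : ∀ h → T (fits id h) → T (fits reflect h) → ⊥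
  fits-disjoint h t t′ = <⇒≢ 0<s (spine-injective (begin
    spine 0                    ≡⟨ cong (relabel id) (colour-spine z<s) ⟨
    relabel id (colour 0)      ≡⟨ proj₁ (Equivalence.to (fits⇔ id h) t) 0<n ⟨
    colour (app h 0)           ≡⟨ proj₁ (Equivalence.to (fits⇔ reflect h) t′) 0<n ⟩
    relabel reflect (colour 0) ≡⟨ cong (relabel reflect) (colour-spine z<s) ⟩
    spine s                    ∎))
    where
    open ≡-Reasoning
    0<n : 0 < n
    0<n = ≤-trans z<s L≤n

  count-fits : ∀ τ → countB (fits τ) (allMaps n n) ≡ placements (map (relabel τ) (layout f)) (multiplicity (layout f))
  count-fits τ =
    trans (subst (λ m → countB (placeable {m} (λ _ → true) cs) (allMaps m n) ≡ placements cs (available (λ _ → true)))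
                 (length-relabelled τ) (count-placeable cs (λ _ → true)))
          (placements-cong cs (All.universal available≡multiplicity cs))
    where cs = map (relabel τ) (layout f)

  placements-identity : placements (map (relabel id) (layout f)) (multiplicity (layout f)) ≡ prodFact f
  placements-identity = begin
    placements (map (relabel id) (layout f)) M
      ≡⟨ cong (λ cs → placements cs M) (trans (map-cong relabel-id (layout f)) (map-id (layout f))) ⟩
    placements (applyUpTo (spine ∘ id) L ++ leafColours id f) M
      ≡⟨ placements-spine-++ L id (leafColours id f) M (λ _ _ e → e) (λ _ → multiplicity-spine)
                             (All-leafColours id f (λ t _ → t , refl)) ⟩
    placements (leafColours id f) M
      ≡⟨ placements-leafColours id f f M refl (λ _ _ e → e) (λ _ → multiplicity-leaf) ⟩
    fallingProduct f f
      ≡⟨ fallingProduct-self f ⟩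
    prodFact f ∎
    where
    open ≡-Reasoning
    M = multiplicity (layout f)

  placements-reflection : placements (map (relabel reflect) (layout f)) (multiplicity (layout f)) ≡ fallingProduct (reverse f) f
  placements-reflection = begin
    placements (map (relabel reflect) (layout f)) M
      ≡⟨ cong (λ cs → placements cs M) relabelled ⟩
    placements (applyUpTo (spine ∘ reflect) L ++ leafColours reflect f) M
      ≡⟨ placements-spine-++ L reflect (leafColours reflect f) M reflect-injective
                             (λ j _ → multiplicity-spine (s≤s (m∸n≤m s j))) (All-leafColours reflect f (λ t _ → reflect t , refl)) ⟩
    placements (leafColours reflect f) M
      ≡⟨ placements-leafColours reflect f (reverse f) M (length-reverse f) reflect-injective
           (λ t t<L → trans (multiplicity-leaf (s≤s (m∸n≤m s t))) (sym (lookupOr-reverse 0 f t<L))) ⟩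
    fallingProduct (reverse f) f ∎
    where
    open ≡-Reasoning
    M = multiplicity (layout f)
    reflect-injective : InjectiveBelow L reflect
    reflect-injective i<L j<L = ∸-cancelˡ-≡ (≤-pred i<L) (≤-pred j<L)
    relabelled : map (relabel reflect) (layout f) ≡ applyUpTo (spine ∘ reflect) L ++ leafColours reflect f
    relabelled = trans (map-++ (relabel reflect) (applyUpTo spine L) (leafColours id f))
                       (cong₂ _++_ (map-applyUpTo spine (relabel reflect) L) (map-relabel-leafColours reflect id f))

  automorphism-count : coeff1n f ≡ prodFact f + fallingProduct (reverse f) f
  automorphism-count = begin
    countB (λ h → isHom f h ∧ hasType1n h) (allMaps n n)
      ≡⟨ countB-cong (λ h → T-injective (isAutomorphism⇔fits h)) (allMaps n n) ⟩
    countB (λ h → fits id h ∨ fits reflect h) (allMaps n n)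
      ≡⟨ countB-∨-disjoint (fits id) (fits reflect) fits-disjoint (allMaps n n) ⟩
    countB (fits id) (allMaps n n) + countB (fits reflect) (allMaps n n)
      ≡⟨ cong₂ _+_ (trans (count-fits id) placements-identity) (trans (count-fits reflect) placements-reflection) ⟩
    prodFact f + fallingProduct (reverse f) f ∎
    where open ≡-Reasoning

proposition2p24 : (f₀ : ℕ) (mid : List ℕ) (fₛ : ℕ) → 1 ≤ f₀ → 1 ≤ fₛ →
    coeff1n (f₀ ∷ mid ++ fₛ ∷ []) ≡ onePlusPalInd (f₀ ∷ mid ++ fₛ ∷ []) * prodFact (f₀ ∷ mid ++ fₛ ∷ [])
proposition2p24 f₀ mid fₛ f₀≥1 fₛ≥1 = begin
  coeff1n f                                  ≡⟨ Automorphisms.automorphism-count f₀ (mid ∷ʳ fₛ) 0<s f₀≥1 last≥1 ⟩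
  prodFact f + fallingProduct (reverse f) f  ≡⟨ prodFact+fallingProduct-reverse f ⟩
  onePlusPalInd f * prodFact f               ∎
  where
  open ≡-Reasoning
  f = f₀ ∷ mid ∷ʳ fₛ
  s≡ : length (mid ∷ʳ fₛ) ≡ suc (length mid)
  s≡ = trans (length-++ mid) (+-comm (length mid) 1)
  0<s : 0 < length (mid ∷ʳ fₛ)
  0<s = subst (0 <_) (sym s≡) z<s
  last≥1 : 1 ≤ lookupOr 0 f (length (mid ∷ʳ fₛ))
  last≥1 = subst (λ i → 1 ≤ lookupOr 0 f i) (sym s≡) (subst (1 ≤_) (sym (lookupOr-∷ʳ 0 (f₀ ∷ mid) fₛ)) fₛ≥1)
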